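{- (a) In QHC, each of the following principles is equivalent to the K-principle $\cdot\,\neg !\neg p\to\,!p$: 1. $\cdot\,(p\to q)\leftrightarrow\,?(!p\to !q)$; 2. $\cdot\,p\lor q\leftrightarrow\,?(!p\lor !q)$; 3. $\cdot\,\exists x\,p(x)\leftrightarrow\,?\exists x\,!p(x)$; 4. $\cdot\,\forall x\,p(x)\leftrightarrow\,?\forall x\,!p(x)$. (b) In QHC, each of the following principles is equivalent to the PC-principle $\cdot\,!?\alpha\to\alpha$: 1. $\cdot\,(\alpha\to\beta)\leftrightarrow\,!(?\alpha\to ?\beta)$; 2. $\cdot\,\alpha\lor\beta\leftrightarrow\,!(?\alpha\lor ?\beta)$; 3. $\cdot\,\exists x\,\alpha(x)\leftrightarrow\,!\exists x\,?\alpha(x)$; 4. $\cdot\,\forall x\,\alpha(x)\leftrightarrow\,!\forall x\,?\alpha(x)$. Here "equivalent" means that each is derivable in QHC from the other.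
   Context: Meta-logical framework. Formulas of a first-order language may contain individual variables and predicate variables. Meta-formulas are built from formulas using meta-conjunction $\&$, meta-implication $\Rightarrow$, and universal meta-quantifiers over individual and predicate variables. A principle $\cdot G$, for a formula $G$, is the meta-formula obtained by universally meta-quantifying all free individual variables of $G$ and then all predicate variables of $G$. A rule $F_1,\dots,F_m/G$ is the meta-formula $\forall^2(\forall^1F_1\,\&\cdots\&\,\forall^1F_m\Rightarrow\forall^1G)$, where $\forall^1$ meta-quantifies the free individual variables of the formula it precedes and $\forall^2$ meta-quantifies all predicate variables occurring. A logic $L$ is given by a derivation system $\mathcal D$, a meta-conjunction of finitely many principles and rules. For a meta-formula $\mathcal F$, $\vdash_L\mathcal F$ means that $\mathcal D\Rightarrow\mathcal F$ is derivable by the natural-deduction meta-rules: introduction and elimination of $\&$, $\Rightarrow$ and the universal meta-quantifiers (elimination allows substituting terms for individual variables and formulas for predicate variables), plus $\alpha$-conversion. The notation $\mathcal F\vdash_L\mathcal G$ means $\vdash_L\mathcal F\Rightarrow\mathcal G$. Language of QHC. It has individual variables and, for each $n\ge0$, countably many $n$-ary problem variables $\alpha,\beta,\gamma,\delta,\theta,\dots$ and countably many $n$-ary proper predicate variables $p,q,\dots$. - A c-formula is $\top$, $\bot$, an atom $p(x_1,\dots,x_n)$, or $?\Phi$ for an i-formula $\Phi$, closed under the classical connectives $\land,\lor,\to,\leftrightarrow,\neg$ and quantifiers $\exists,\forall$. - An i-formula is $\checkmark$ (triviality), $\curlywedge$ (absurdity), an atom $\alpha(x_1,\dots,x_n)$,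 or $!F$ for a c-formula $F$, closed under the intuitionistic connectives $\land,\lor,\to,\leftrightarrow,\neg$ (with $\neg\Phi:=\Phi\to\curlywedge$) and quantifiers $\exists,\forall$. Connectives applied to c-formulas are classical; those applied to i-formulas are intuitionistic. QHC is the logic whose derivation system consists of: - (0a) all laws and rules of classical predicate logic QC, for c-formulas; - (0b) all laws and rules of intuitionistic predicate logic QH, for i-formulas; - the principles $\cdot\,?(\gamma\land\delta)\leftrightarrow ?\gamma\land ?\delta$, $\cdot\,?(\gamma\lor\delta)\leftrightarrow ?\gamma\lor ?\delta$, $\cdot\,?(\gamma\to\delta)\to(?\gamma\to ?\delta)$, $\cdot\,\neg ?\curlywedge$, $\cdot\,?\exists x\,\theta(x)\leftrightarrow\exists x\,?\theta(x)$, $\cdot\,?\forall x\,\theta(x)\to\forall x\,?\theta(x)$, $\cdot\,\gamma\to\,!?\gamma$, $\cdot\,\neg !\bot$, $\cdot\,?!p\to p$, $\cdot\,!p\to\,!?!p$ and $\cdot\,!(p\to q)\to(!p\to !q)$; - the rules $!p/p$ and $p/!p$. -}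

module Defs where

open import Data.Nat using (ℕ; zero; suc; _⊔_; pred; _≡ᵇ_; _<ᵇ_)
open import Data.Bool using (Bool; true; false; if_then_else_; _∧_)
open import Data.Vec using (Vec; []; _∷_)
import Data.Vec as Vec
open import Data.List using (List; []; _∷_; _++_; foldr; map; deduplicateᵇ)
open import Data.List.Membership.Propositional using (_∈_)
open import Data.Product using (_×_; _,_)

-- Individual variables are de Bruijn indices (ℕ); the only terms are
-- individual variables.  Object quantifiers (∃, ∀ for c- and i-formulas)
-- and the individual meta-quantifier ∀₁ bind index 0.
--
-- Predicate variables come in two sorts (problem variables / proper
-- predicate variables) and every arity n.  A predicate variable is
-- given by its sort, its arity n and an index k; the meta-quantifier
-- ∀₂ s n binds index 0 of the class (s , n).

data Sort : Set where
  prb : Sort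
  prp : Sort

sameSort : Sort → Sort → Bool
sameSort prb prb = true
sameSort prp prp = true
sameSort _   _   = false

sameClass : Sort → ℕ → Sort → ℕ → Bool
sameClass s n s' n' = sameSort s s' ∧ (n ≡ᵇ n')

infixr 4 _→c_ _→i_
infixr 5 _∨c_ _∨i_
infixr 6 _∧c_ _∧i_
infixr 8 ⁇_ !_ ¬c_ ¬i_

mutual
  data CF : Set where
    ⊤c ⊥c : CF
    patm  : (n k : ℕ) → Vec ℕ n → CF
    ⁇_    : IF → CF
    _∧c_ _∨c_ _→c_ : CF → CF → CF
    ∃c ∀c : CF → CF

  data IF : Set where
    ✓ ⋏   : IF                            -- triviality, absurdity
    ratm  : (n k : ℕ) → Vec ℕ n → IF
    !_    : CF → IF
    _∧i_ _∨i_ _→i_ : IF → IF → IF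
    ∃i ∀i : IF → IF

¬c_ : CF → CF
¬c F = F →c ⊥c

¬i_ : IF → IF
¬i Φ = Φ →i ⋏

_↔c_ : CF → CF → CF
F ↔c G = (F →c G) ∧c (G →c F)

_↔i_ : IF → IF → IF
Φ ↔i Ψ = (Φ →i Ψ) ∧i (Ψ →i Φ)

infix 3 _↔c_ _↔i_

-- formulas of a given sort (what may be substituted for a predicate
-- variable of that sort)
El : Sort → Set
El prb = IF
El prp = CF

-- Renaming (= substitution, since terms are variables) of individuals

lift : (ℕ → ℕ) → ℕ → ℕ
lift ρ zero    = zero
lift ρ (suc i) = suc (ρ i)

mutual
  renC : (ℕ → ℕ) → CF → CF
  renC ρ ⊤c = ⊤c
  renC ρ ⊥c = ⊥c
  renC ρ (patm n k ys) = patm n k (Vec.map ρ ys)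
  renC ρ (⁇ Φ) = ⁇ renI ρ Φ
  renC ρ (F ∧c G) = renC ρ F ∧c renC ρ G
  renC ρ (F ∨c G) = renC ρ F ∨c renC ρ G
  renC ρ (F →c G) = renC ρ F →c renC ρ G
  renC ρ (∃c F) = ∃c (renC (lift ρ) F)
  renC ρ (∀c F) = ∀c (renC (lift ρ) F)

  renI : (ℕ → ℕ) → IF → IF
  renI ρ ✓ = ✓
  renI ρ ⋏ = ⋏
  renI ρ (ratm n k ys) = ratm n k (Vec.map ρ ys)
  renI ρ (! F) = ! renC ρ F
  renI ρ (Φ ∧i Ψ) = renI ρ Φ ∧i renI ρ Ψ
  renI ρ (Φ ∨i Ψ) = renI ρ Φ ∨i renI ρ Ψ
  renI ρ (Φ →i Ψ) = renI ρ Φ →i renI ρ Ψ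
  renI ρ (∃i Φ) = ∃i (renI (lift ρ) Φ)
  renI ρ (∀i Φ) = ∀i (renI (lift ρ) Φ)

renEl : (s : Sort) → (ℕ → ℕ) → El s → El s
renEl prb ρ Φ = renI ρ Φ
renEl prp ρ F = renC ρ F

bump : Sort → ℕ → ℕ → Sort → ℕ → ℕ → ℕ
bump s n c s' m k =
  if sameClass s n s' m then (if k <ᵇ c then k else suc k) else k

mutual
  pshC : Sort → ℕ → ℕ → CF → CF
  pshC s n c ⊤c = ⊤c
  pshC s n c ⊥c = ⊥c
  pshC s n c (patm m k ys) = patm m (bump s n c prp m k) ys
  pshC s n c (⁇ Φ) = ⁇ pshI s n c Φ
  pshC s n c (F ∧c G) = pshC s n c F ∧c pshC s n c G
  pshC s n c (F ∨c G) = pshC s n c F ∨c pshC s n c G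
  pshC s n c (F →c G) = pshC s n c F →c pshC s n c G
  pshC s n c (∃c F) = ∃c (pshC s n c F)
  pshC s n c (∀c F) = ∀c (pshC s n c F)

  pshI : Sort → ℕ → ℕ → IF → IF
  pshI s n c ✓ = ✓
  pshI s n c ⋏ = ⋏
  pshI s n c (ratm m k ys) = ratm m (bump s n c prb m k) ys
  pshI s n c (! F) = ! pshC s n c F
  pshI s n c (Φ ∧i Ψ) = pshI s n c Φ ∧i pshI s n c Ψ
  pshI s n c (Φ ∨i Ψ) = pshI s n c Φ ∨i pshI s n c Ψ
  pshI s n c (Φ →i Ψ) = pshI s n c Φ →i pshI s n c Ψ
  pshI s n c (∃i Φ) = ∃i (pshI s n c Φ)
  pshI s n c (∀i Φ) = ∀i (pshI s n c Φ)

pshEl : Sort → ℕ → ℕ → (t : Sort) → El t → El t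
pshEl s n c prb Φ = pshI s n c Φ
pshEl s n c prp F = pshC s n c F

-- A substituend for an n-ary predicate variable is a formula G whose
-- individual indices 0,…,n-1 are the n argument places and whose
-- indices n, n+1, … denote the free individual variables 0, 1, ….
-- Substituting G for the variable (s , n , k) replaces each atom
-- P_k(y₁,…,yₙ) by G with its argument places instantiated by y₁,…,yₙ;
-- indices > k of the class (s , n) are decremented (the binder
-- disappears).

inst : ∀ {m} → Vec ℕ m → ℕ → ℕ
inst []       i       = i
inst (y ∷ ys) zero    = y
inst (y ∷ ys) (suc i) = inst ys i

-- shift the free individual variables of a substituend with n places
upFrom : ℕ → ℕ → ℕ
upFrom n i = if i <ᵇ n then i else suc i

hitIdx : ℕ → ℕ → ℕ
hitIdx k j = if k <ᵇ j then pred j else j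

mutual
  psubC : (s : Sort) → ℕ → ℕ → El s → CF → CF
  psubC s n k G ⊤c = ⊤c
  psubC s n k G ⊥c = ⊥c
  psubC prb n k G (patm m j ys) = patm m j ys
  psubC prp n k G (patm m j ys) =
    if m ≡ᵇ n
    then (if j ≡ᵇ k then renC (inst ys) G else patm m (hitIdx k j) ys)
    else patm m j ys
  psubC s n k G (⁇ Φ) = ⁇ psubI s n k G Φ
  psubC s n k G (F ∧c H) = psubC s n k G F ∧c psubC s n k G H
  psubC s n k G (F ∨c H) = psubC s n k G F ∨c psubC s n k G H
  psubC s n k G (F →c H) = psubC s n k G F →c psubC s n k G H
  psubC s n k G (∃c F) = ∃c (psubC s n k (renEl s (upFrom n) G) F)
  psubC s n k G (∀c F) = ∀c (psubC s n k (renEl s (upFrom n) G) F)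

  psubI : (s : Sort) → ℕ → ℕ → El s → IF → IF
  psubI s n k G ✓ = ✓
  psubI s n k G ⋏ = ⋏
  psubI prp n k G (ratm m j ys) = ratm m j ys
  psubI prb n k G (ratm m j ys) =
    if m ≡ᵇ n
    then (if j ≡ᵇ k then renI (inst ys) G else ratm m (hitIdx k j) ys)
    else ratm m j ys
  psubI s n k G (! F) = ! psubC s n k G F
  psubI s n k G (Φ ∧i Ψ) = psubI s n k G Φ ∧i psubI s n k G Ψ
  psubI s n k G (Φ ∨i Ψ) = psubI s n k G Φ ∨i psubI s n k G Ψ
  psubI s n k G (Φ →i Ψ) = psubI s n k G Φ →i psubI s n k G Ψ
  psubI s n k G (∃i Φ) = ∃i (psubI s n k (renEl s (upFrom n) G) Φ)
  psubI s n k G (∀i Φ) = ∀i (psubI s n k (renEl s (upFrom n) G) Φ)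

infixr 2 _&_
infixr 1 _⇒_

data MF : Set where
  c⟨_⟩ : CF → MF
  i⟨_⟩ : IF → MF
  _&_ _⇒_ : MF → MF → MF
  ∀₁   : MF → MF
  ∀₂   : Sort → ℕ → MF → MF

renM : (ℕ → ℕ) → MF → MF
renM ρ c⟨ F ⟩ = c⟨ renC ρ F ⟩
renM ρ i⟨ Φ ⟩ = i⟨ renI ρ Φ ⟩
renM ρ (A & B) = renM ρ A & renM ρ B
renM ρ (A ⇒ B) = renM ρ A ⇒ renM ρ B
renM ρ (∀₁ A) = ∀₁ (renM (lift ρ) A)
renM ρ (∀₂ s n A) = ∀₂ s n (renM ρ A)

pshM : Sort → ℕ → ℕ → MF → MF
pshM s n c c⟨ F ⟩ = c⟨ pshC s n c F ⟩
pshM s n c i⟨ Φ ⟩ = i⟨ pshI s n c Φ ⟩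
pshM s n c (A & B) = pshM s n c A & pshM s n c B
pshM s n c (A ⇒ B) = pshM s n c A ⇒ pshM s n c B
pshM s n c (∀₁ A) = ∀₁ (pshM s n c A)
pshM s n c (∀₂ s' m A) =
  ∀₂ s' m (pshM s n (if sameClass s n s' m then suc c else c) A)

psubM : (s : Sort) → ℕ → ℕ → El s → MF → MF
psubM s n k G c⟨ F ⟩ = c⟨ psubC s n k G F ⟩
psubM s n k G i⟨ Φ ⟩ = i⟨ psubI s n k G Φ ⟩
psubM s n k G (A & B) = psubM s n k G A & psubM s n k G B
psubM s n k G (A ⇒ B) = psubM s n k G A ⇒ psubM s n k G B
psubM s n k G (∀₁ A) = ∀₁ (psubM s n k (renEl s (upFrom n) G) A)
psubM s n k G (∀₂ s' m A) =
  ∀₂ s' m (psubM s n (if sameClass s n s' m then suc k else k)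
                 (pshEl s' m 0 s G) A)

inst₁ : ℕ → ℕ → ℕ
inst₁ t zero    = t
inst₁ t (suc i) = i

infix 0 _⊢ₘ_

data _⊢ₘ_ : List MF → MF → Set where
  hyp  : ∀ {Γ A} → A ∈ Γ → Γ ⊢ₘ A
  &I   : ∀ {Γ A B} → Γ ⊢ₘ A → Γ ⊢ₘ B → Γ ⊢ₘ A & B
  &E₁  : ∀ {Γ A B} → Γ ⊢ₘ A & B → Γ ⊢ₘ A
  &E₂  : ∀ {Γ A B} → Γ ⊢ₘ A & B → Γ ⊢ₘ B
  ⇒I   : ∀ {Γ A B} → (A ∷ Γ) ⊢ₘ B → Γ ⊢ₘ A ⇒ B
  ⇒E   : ∀ {Γ A B} → Γ ⊢ₘ A ⇒ B → Γ ⊢ₘ A → Γ ⊢ₘ B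
  ∀₁I  : ∀ {Γ A} → map (renM suc) Γ ⊢ₘ A → Γ ⊢ₘ ∀₁ A
  ∀₁E  : ∀ {Γ A} → Γ ⊢ₘ ∀₁ A → (t : ℕ) → Γ ⊢ₘ renM (inst₁ t) A
  ∀₂I  : ∀ {Γ A s n} → map (pshM s n 0) Γ ⊢ₘ A → Γ ⊢ₘ ∀₂ s n A
  ∀₂E  : ∀ {Γ A s n} → Γ ⊢ₘ ∀₂ s n A → (G : El s) → Γ ⊢ₘ psubM s n 0 G A

data Fm : Set where
  c : CF → Fm
  i : IF → Fm

atomM : Fm → MF
atomM (c F) = c⟨ F ⟩
atomM (i Φ) = i⟨ Φ ⟩

-- number of free individual variable indices (all free indices are < this)
maxv : ∀ {m} → Vec ℕ m → ℕ
maxv []       = 0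
maxv (y ∷ ys) = suc y ⊔ maxv ys

mutual
  bndC : CF → ℕ
  bndC ⊤c = 0
  bndC ⊥c = 0
  bndC (patm n k ys) = maxv ys
  bndC (⁇ Φ) = bndI Φ
  bndC (F ∧c G) = bndC F ⊔ bndC G
  bndC (F ∨c G) = bndC F ⊔ bndC G
  bndC (F →c G) = bndC F ⊔ bndC G
  bndC (∃c F) = pred (bndC F)
  bndC (∀c F) = pred (bndC F)

  bndI : IF → ℕ
  bndI ✓ = 0
  bndI ⋏ = 0
  bndI (ratm n k ys) = maxv ys
  bndI (! F) = bndC F
  bndI (Φ ∧i Ψ) = bndI Φ ⊔ bndI Ψ
  bndI (Φ ∨i Ψ) = bndI Φ ⊔ bndI Ψ
  bndI (Φ →i Ψ) = bndI Φ ⊔ bndI Ψ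
  bndI (∃i Φ) = pred (bndI Φ)
  bndI (∀i Φ) = pred (bndI Φ)

bnd : Fm → ℕ
bnd (c F) = bndC F
bnd (i Φ) = bndI Φ

Occ : Set
Occ = Sort × ℕ × ℕ

mutual
  pvC : CF → List Occ
  pvC ⊤c = []
  pvC ⊥c = []
  pvC (patm n k ys) = (prp , n , k) ∷ []
  pvC (⁇ Φ) = pvI Φ
  pvC (F ∧c G) = pvC F ++ pvC G
  pvC (F ∨c G) = pvC F ++ pvC G
  pvC (F →c G) = pvC F ++ pvC G
  pvC (∃c F) = pvC F
  pvC (∀c F) = pvC F

  pvI : IF → List Occ
  pvI ✓ = []
  pvI ⋏ = []
  pvI (ratm n k ys) = (prb , n , k) ∷ []
  pvI (! F) = pvC F
  pvI (Φ ∧i Ψ) = pvI Φ ++ pvI Ψ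
  pvI (Φ ∨i Ψ) = pvI Φ ++ pvI Ψ
  pvI (Φ →i Ψ) = pvI Φ ++ pvI Ψ
  pvI (∃i Φ) = pvI Φ
  pvI (∀i Φ) = pvI Φ

pv : Fm → List Occ
pv (c F) = pvC F
pv (i Φ) = pvI Φ

iter : ℕ → (MF → MF) → MF → MF
iter zero    f A = A
iter (suc n) f A = f (iter n f A)

∀¹ : Fm → MF
∀¹ G = iter (bnd G) ∀₁ (atomM G)

count : Sort → ℕ → List Occ → ℕ
count s n = foldr (λ { (s' , m , k) r →
                        if sameClass s n s' m then suc k ⊔ r else r }) 0

classes : List Occ → List (Sort × ℕ)
classes os = deduplicateᵇ (λ { (s , n) (s' , m) → sameClass s n s' m })
                          (map (λ { (s , n , k) → (s , n) }) os)

∀² : List Occ → MF → MF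
∀² os A = foldr (λ { (s , n) B → iter (count s n os) (∀₂ s n) B }) A (classes os)

principle : Fm → MF
principle G = ∀² (pv G) (∀¹ G)

conjM : MF → List MF → MF
conjM A []       = A
conjM A (B ∷ Bs) = A & conjM B Bs

rule : Fm → List Fm → Fm → MF
rule F Fs G =
  ∀² (foldr (λ H os → pv H ++ os) (pv G) (F ∷ Fs))
     (conjM (∀¹ F) (map ∀¹ Fs) ⇒ ∀¹ G)

p₀ q₀ r₀ : CF
p₀ = patm 0 0 []
q₀ = patm 0 1 []
r₀ = patm 0 2 []

p₁ : ℕ → CF
p₁ x = patm 1 0 (x ∷ [])

α₀ β₀ γ₀ : IF
α₀ = ratm 0 0 []
β₀ = ratm 0 1 []
γ₀ = ratm 0 2 []

θ₁ : ℕ → IF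
θ₁ x = ratm 1 0 (x ∷ [])

QC : List MF
QC =
    principle (c (p₀ →c (q₀ →c p₀)))
  ∷ principle (c ((p₀ →c (q₀ →c r₀)) →c ((p₀ →c q₀) →c (p₀ →c r₀))))
  ∷ principle (c (p₀ ∧c q₀ →c p₀))
  ∷ principle (c (p₀ ∧c q₀ →c q₀))
  ∷ principle (c (p₀ →c (q₀ →c p₀ ∧c q₀)))
  ∷ principle (c (p₀ →c p₀ ∨c q₀))
  ∷ principle (c (q₀ →c p₀ ∨c q₀))
  ∷ principle (c ((p₀ →c r₀) →c ((q₀ →c r₀) →c (p₀ ∨c q₀ →c r₀))))
  ∷ principle (c (⊥c →c p₀))
  ∷ principle (c ⊤c)
  ∷ principle (c (¬c ¬c p₀ →c p₀))
  ∷ principle (c (∀c (p₁ 0) →c p₁ 0))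
  ∷ principle (c (p₁ 0 →c ∃c (p₁ 0)))
  ∷ rule (c p₀) (c (p₀ →c q₀) ∷ []) (c q₀)
  ∷ rule (c (p₀ →c p₁ 0)) [] (c (p₀ →c ∀c (p₁ 0)))
  ∷ rule (c (p₁ 0 →c p₀)) [] (c (∃c (p₁ 0) →c p₀))
  ∷ []

QH : List MF
QH =
    principle (i (α₀ →i (β₀ →i α₀)))
  ∷ principle (i ((α₀ →i (β₀ →i γ₀)) →i ((α₀ →i β₀) →i (α₀ →i γ₀))))
  ∷ principle (i (α₀ ∧i β₀ →i α₀))
  ∷ principle (i (α₀ ∧i β₀ →i β₀))
  ∷ principle (i (α₀ →i (β₀ →i α₀ ∧i β₀)))
  ∷ principle (i (α₀ →i α₀ ∨i β₀))
  ∷ principle (i (β₀ →i α₀ ∨i β₀))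
  ∷ principle (i ((α₀ →i γ₀) →i ((β₀ →i γ₀) →i (α₀ ∨i β₀ →i γ₀))))
  ∷ principle (i (⋏ →i α₀))
  ∷ principle (i ✓)
  ∷ principle (i (∀i (θ₁ 0) →i θ₁ 0))
  ∷ principle (i (θ₁ 0 →i ∃i (θ₁ 0)))
  ∷ rule (i α₀) (i (α₀ →i β₀) ∷ []) (i β₀)
  ∷ rule (i (α₀ →i θ₁ 0)) [] (i (α₀ →i ∀i (θ₁ 0)))
  ∷ rule (i (θ₁ 0 →i α₀)) [] (i (∃i (θ₁ 0) →i α₀))
  ∷ []

QHCax : List MF
QHCax =
    principle (c (⁇ (α₀ ∧i β₀) ↔c ⁇ α₀ ∧c ⁇ β₀))
  ∷ principle (c (⁇ (α₀ ∨i β₀) ↔c ⁇ α₀ ∨c ⁇ β₀))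
  ∷ principle (c (⁇ (α₀ →i β₀) →c (⁇ α₀ →c ⁇ β₀)))
  ∷ principle (c (¬c ⁇ ⋏))
  ∷ principle (c (⁇ ∃i (θ₁ 0) ↔c ∃c (⁇ θ₁ 0)))
  ∷ principle (c (⁇ ∀i (θ₁ 0) →c ∀c (⁇ θ₁ 0)))
  ∷ principle (i (α₀ →i ! ⁇ α₀))
  ∷ principle (i (¬i ! ⊥c))
  ∷ principle (c (⁇ ! p₀ →c p₀))
  ∷ principle (i (! p₀ →i ! ⁇ ! p₀))
  ∷ principle (i (! (p₀ →c q₀) →i (! p₀ →i ! q₀)))
  ∷ rule (i (! p₀)) [] (c p₀)
  ∷ rule (c p₀) [] (i (! p₀))
  ∷ []

QHC : MF
QHC = conjM (principle (c ⊤c)) (QC ++ QH ++ QHCax)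

⊢QHC_ : MF → Set
⊢QHC 𝓕 = [] ⊢ₘ QHC ⇒ 𝓕

_⊢QHC_ : MF → MF → Set
𝓕 ⊢QHC 𝓖 = ⊢QHC (𝓕 ⇒ 𝓖)

_≣QHC_ : MF → MF → Set
𝓕 ≣QHC 𝓖 = (𝓕 ⊢QHC 𝓖) × (𝓖 ⊢QHC 𝓕)

Kprinciple : MF
Kprinciple = principle (i (¬i ! (¬c p₀) →i ! p₀))

Ka1 Ka2 Ka3 Ka4 : MF
Ka1 = principle (c ((p₀ →c q₀) ↔c ⁇ (! p₀ →i ! q₀)))
Ka2 = principle (c (p₀ ∨c q₀ ↔c ⁇ (! p₀ ∨i ! q₀)))
Ka3 = principle (c (∃c (p₁ 0) ↔c ⁇ ∃i (! p₁ 0)))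
Ka4 = principle (c (∀c (p₁ 0) ↔c ⁇ ∀i (! p₁ 0)))

PCprinciple : MF
PCprinciple = principle (i (! ⁇ α₀ →i α₀))

Pb1 Pb2 Pb3 Pb4 : MF
Pb1 = principle (i ((α₀ →i β₀) ↔i ! (⁇ α₀ →c ⁇ β₀)))
Pb2 = principle (i (α₀ ∨i β₀ ↔i ! (⁇ α₀ ∨c ⁇ β₀)))
Pb3 = principle (i (∃i (θ₁ 0) ↔i ! ∃c (⁇ θ₁ 0)))
Pb4 = principle (i (∀i (θ₁ 0) ↔i ! ∀c (⁇ θ₁ 0)))

module Submission where

-- The K-part rests on the schema A → ?!A.  It follows from K instantiated at
-- B := A → ?!A, because !¬B yields both !A (hence !?!A) and !¬?!A, so ¬!¬B is a
-- theorem and the rule !p/p gives B.  Conversely, at A := ¬p it gives K: from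
-- ?¬!¬p and ¬p we would get ?!¬p and hence ?⋏.  Given A → ?!A and the converse
-- axiom ?!A → A, the bridge axioms for ? let ? commute with the connective or
-- quantifier of each Ka_i placed under !; conversely, each Ka_i instantiated at
-- ⊤ or ⊥, or with a vacuous quantifier, returns A → ?!A.  The PC-part is dual:
-- PC makes the unit γ → !?γ invertible, which lets ! commute with the
-- connectives under ?, and each Pb_i at ✓ or ⋏, or with a vacuous quantifier,
-- returns !?α → α.

open import Defs
open import Data.Nat using (ℕ; zero; suc; _≡ᵇ_; _<ᵇ_)
open import Data.Bool using (true; false; if_then_else_)
open import Data.Fin using (Fin; zero; suc; #_)
open import Data.Vec.Properties using (map-cong; map-id)
open import Data.List using (List; []; _∷_; _++_; map; length; lookup)
open import Data.List.Membership.Propositional using (_∈_)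
open import Data.List.Membership.Propositional.Properties using (∈-map⁺)
open import Data.List.Relation.Unary.Any using (here; there)
open import Data.Product using (_×_; _,_)
open import Relation.Binary.PropositionalEquality

≡ᵇ-sym : ∀ m n → (m ≡ᵇ n) ≡ (n ≡ᵇ m)
≡ᵇ-sym zero    zero    = refl
≡ᵇ-sym zero    (suc n) = refl
≡ᵇ-sym (suc m) zero    = refl
≡ᵇ-sym (suc m) (suc n) = ≡ᵇ-sym m n

punchIn : ℕ → ℕ → ℕ
punchIn k j = if j <ᵇ k then j else suc j

punchIn-suc : ∀ k j → punchIn (suc k) (suc j) ≡ suc (punchIn k j)
punchIn-suc k j with j <ᵇ k
... | true  = refl
... | false = refl

hitIdx-suc : ∀ k j → hitIdx (suc k) (suc j) ≡ suc (hitIdx k j)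
hitIdx-suc k zero    = refl
hitIdx-suc k (suc j) with k <ᵇ suc j
... | true  = refl
... | false = refl

punchIn-≢ᵇ : ∀ k j → (punchIn k j ≡ᵇ k) ≡ false
punchIn-≢ᵇ zero    j       = refl
punchIn-≢ᵇ (suc k) zero    = refl
punchIn-≢ᵇ (suc k) (suc j) rewrite punchIn-suc k j = punchIn-≢ᵇ k j

hitIdx-punchIn : ∀ k j → hitIdx k (punchIn k j) ≡ j
hitIdx-punchIn zero    j       = refl
hitIdx-punchIn (suc k) zero    = refl
hitIdx-punchIn (suc k) (suc j) = begin
  hitIdx (suc k) (punchIn (suc k) (suc j)) ≡⟨ cong (hitIdx (suc k)) (punchIn-suc k j) ⟩
  hitIdx (suc k) (suc (punchIn k j))       ≡⟨ hitIdx-suc k (punchIn k j) ⟩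
  suc (hitIdx k (punchIn k j))             ≡⟨ cong suc (hitIdx-punchIn k j) ⟩
  suc j                                    ∎
  where open ≡-Reasoning

-- The atom clauses of psubC/psubI and of pshC/pshI, for an atom of arity m
-- and index j, when substituting for (or shifting) arity n at index k.
substAtom : {A : Set} → ℕ → ℕ → ℕ → ℕ → A → (ℕ → A) → A
substAtom n k m j x atom =
  if m ≡ᵇ n then (if j ≡ᵇ k then x else atom (hitIdx k j)) else atom j

shiftIdx : ℕ → ℕ → ℕ → ℕ → ℕ
shiftIdx n k m j = if n ≡ᵇ m then punchIn k j else j

substAtom-shiftIdx : {A : Set} (n k m j : ℕ) (x : A) (atom : ℕ → A) →
                     substAtom n k m (shiftIdx n k m j) x atom ≡ atom j
substAtom-shiftIdx n k m j x atom rewrite ≡ᵇ-sym m n with n ≡ᵇ m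
... | false = refl
... | true  = begin
  (if punchIn k j ≡ᵇ k then x else atom (hitIdx k (punchIn k j)))
    ≡⟨ cong (if_then x else atom (hitIdx k (punchIn k j))) (punchIn-≢ᵇ k j) ⟩
  atom (hitIdx k (punchIn k j))
    ≡⟨ cong atom (hitIdx-punchIn k j) ⟩
  atom j ∎
  where open ≡-Reasoning

substAtom-shiftIdx² : {A : Set} (n m j : ℕ) (x : A) (atom : ℕ → A) →
  substAtom n 1 m (shiftIdx n 0 m (shiftIdx n 0 m j)) x atom ≡ atom (shiftIdx n 0 m j)
substAtom-shiftIdx² n m j x atom rewrite ≡ᵇ-sym m n with n ≡ᵇ m
... | false = refl
... | true  = refl

lift-id : ∀ {ρ} → (∀ x → ρ x ≡ x) → ∀ x → lift ρ x ≡ x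
lift-id ρ≗id zero    = refl
lift-id ρ≗id (suc x) = cong suc (ρ≗id x)

mutual
  renC-id : ∀ {ρ} → (∀ x → ρ x ≡ x) → ∀ F → renC ρ F ≡ F
  renC-id ρ≗id ⊤c            = refl
  renC-id ρ≗id ⊥c            = refl
  renC-id ρ≗id (patm n k ys) = cong (patm n k) (trans (map-cong ρ≗id ys) (map-id ys))
  renC-id ρ≗id (⁇ Φ)         = cong ⁇_ (renI-id ρ≗id Φ)
  renC-id ρ≗id (F ∧c G)      = cong₂ _∧c_ (renC-id ρ≗id F) (renC-id ρ≗id G)
  renC-id ρ≗id (F ∨c G)      = cong₂ _∨c_ (renC-id ρ≗id F) (renC-id ρ≗id G)
  renC-id ρ≗id (F →c G)      = cong₂ _→c_ (renC-id ρ≗id F) (renC-id ρ≗id G)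
  renC-id ρ≗id (∃c F)        = cong ∃c (renC-id (lift-id ρ≗id) F)
  renC-id ρ≗id (∀c F)        = cong ∀c (renC-id (lift-id ρ≗id) F)

  renI-id : ∀ {ρ} → (∀ x → ρ x ≡ x) → ∀ Φ → renI ρ Φ ≡ Φ
  renI-id ρ≗id ✓             = refl
  renI-id ρ≗id ⋏             = refl
  renI-id ρ≗id (ratm n k ys) = cong (ratm n k) (trans (map-cong ρ≗id ys) (map-id ys))
  renI-id ρ≗id (! F)         = cong !_ (renC-id ρ≗id F)
  renI-id ρ≗id (Φ ∧i Ψ)      = cong₂ _∧i_ (renI-id ρ≗id Φ) (renI-id ρ≗id Ψ)
  renI-id ρ≗id (Φ ∨i Ψ)      = cong₂ _∨i_ (renI-id ρ≗id Φ) (renI-id ρ≗id Ψ)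
  renI-id ρ≗id (Φ →i Ψ)      = cong₂ _→i_ (renI-id ρ≗id Φ) (renI-id ρ≗id Ψ)
  renI-id ρ≗id (∃i Φ)        = cong ∃i (renI-id (lift-id ρ≗id) Φ)
  renI-id ρ≗id (∀i Φ)        = cong ∀i (renI-id (lift-id ρ≗id) Φ)

renEl-id : ∀ s (A : El s) → renEl s (λ x → x) A ≡ A
renEl-id prb = renI-id (λ _ → refl)
renEl-id prp = renC-id (λ _ → refl)

mutual
  psubC-pshC : ∀ s n k (X : El s) F → psubC s n k X (pshC s n k F) ≡ F
  psubC-pshC s   n k X ⊤c = refl
  psubC-pshC s   n k X ⊥c = refl
  psubC-pshC prb n k X (patm m j ys) = refl
  psubC-pshC prp n k X (patm m j ys) =
    substAtom-shiftIdx n k m j (renC (inst ys) X) (λ j → patm m j ys)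
  psubC-pshC s n k X (⁇ Φ)    = cong ⁇_ (psubI-pshI s n k X Φ)
  psubC-pshC s n k X (F ∧c G) = cong₂ _∧c_ (psubC-pshC s n k X F) (psubC-pshC s n k X G)
  psubC-pshC s n k X (F ∨c G) = cong₂ _∨c_ (psubC-pshC s n k X F) (psubC-pshC s n k X G)
  psubC-pshC s n k X (F →c G) = cong₂ _→c_ (psubC-pshC s n k X F) (psubC-pshC s n k X G)
  psubC-pshC s n k X (∃c F)   = cong ∃c (psubC-pshC s n k _ F)
  psubC-pshC s n k X (∀c F)   = cong ∀c (psubC-pshC s n k _ F)

  psubI-pshI : ∀ s n k (X : El s) Φ → psubI s n k X (pshI s n k Φ) ≡ Φ
  psubI-pshI s   n k X ✓ = refl
  psubI-pshI s   n k X ⋏ = refl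
  psubI-pshI prp n k X (ratm m j ys) = refl
  psubI-pshI prb n k X (ratm m j ys) =
    substAtom-shiftIdx n k m j (renI (inst ys) X) (λ j → ratm m j ys)
  psubI-pshI s n k X (! F)    = cong !_ (psubC-pshC s n k X F)
  psubI-pshI s n k X (Φ ∧i Ψ) = cong₂ _∧i_ (psubI-pshI s n k X Φ) (psubI-pshI s n k X Ψ)
  psubI-pshI s n k X (Φ ∨i Ψ) = cong₂ _∨i_ (psubI-pshI s n k X Φ) (psubI-pshI s n k X Ψ)
  psubI-pshI s n k X (Φ →i Ψ) = cong₂ _→i_ (psubI-pshI s n k X Φ) (psubI-pshI s n k X Ψ)
  psubI-pshI s n k X (∃i Φ)   = cong ∃i (psubI-pshI s n k _ Φ)
  psubI-pshI s n k X (∀i Φ)   = cong ∀i (psubI-pshI s n k _ Φ)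

mutual
  psubC-pshC² : ∀ s n (X : El s) F → psubC s n 1 X (pshC s n 0 (pshC s n 0 F)) ≡ pshC s n 0 F
  psubC-pshC² s   n X ⊤c = refl
  psubC-pshC² s   n X ⊥c = refl
  psubC-pshC² prb n X (patm m j ys) = refl
  psubC-pshC² prp n X (patm m j ys) =
    substAtom-shiftIdx² n m j (renC (inst ys) X) (λ j → patm m j ys)
  psubC-pshC² s n X (⁇ Φ)    = cong ⁇_ (psubI-pshI² s n X Φ)
  psubC-pshC² s n X (F ∧c G) = cong₂ _∧c_ (psubC-pshC² s n X F) (psubC-pshC² s n X G)
  psubC-pshC² s n X (F ∨c G) = cong₂ _∨c_ (psubC-pshC² s n X F) (psubC-pshC² s n X G)
  psubC-pshC² s n X (F →c G) = cong₂ _→c_ (psubC-pshC² s n X F) (psubC-pshC² s n X G)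
  psubC-pshC² s n X (∃c F)   = cong ∃c (psubC-pshC² s n _ F)
  psubC-pshC² s n X (∀c F)   = cong ∀c (psubC-pshC² s n _ F)

  psubI-pshI² : ∀ s n (X : El s) Φ → psubI s n 1 X (pshI s n 0 (pshI s n 0 Φ)) ≡ pshI s n 0 Φ
  psubI-pshI² s   n X ✓ = refl
  psubI-pshI² s   n X ⋏ = refl
  psubI-pshI² prp n X (ratm m j ys) = refl
  psubI-pshI² prb n X (ratm m j ys) =
    substAtom-shiftIdx² n m j (renI (inst ys) X) (λ j → ratm m j ys)
  psubI-pshI² s n X (! F)    = cong !_ (psubC-pshC² s n X F)
  psubI-pshI² s n X (Φ ∧i Ψ) = cong₂ _∧i_ (psubI-pshI² s n X Φ) (psubI-pshI² s n X Ψ)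
  psubI-pshI² s n X (Φ ∨i Ψ) = cong₂ _∨i_ (psubI-pshI² s n X Φ) (psubI-pshI² s n X Ψ)
  psubI-pshI² s n X (Φ →i Ψ) = cong₂ _→i_ (psubI-pshI² s n X Φ) (psubI-pshI² s n X Ψ)
  psubI-pshI² s n X (∃i Φ)   = cong ∃i (psubI-pshI² s n _ Φ)
  psubI-pshI² s n X (∀i Φ)   = cong ∀i (psubI-pshI² s n _ Φ)

substEl : (s : Sort) → ℕ → El s → El s → El s
substEl prb k A B = psubI prb 0 k A B
substEl prp k A B = psubC prp 0 k A B

shiftEl : (s : Sort) → El s → El s
shiftEl s = pshEl s 0 0 s

substEl-shiftEl : ∀ s (A B : El s) → substEl s 0 A (shiftEl s B) ≡ B
substEl-shiftEl prb = psubI-pshI prb 0 0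
substEl-shiftEl prp = psubC-pshC prp 0 0

substEl-shiftEl² : ∀ s (A B : El s) → substEl s 1 A (shiftEl s (shiftEl s B)) ≡ shiftEl s B
substEl-shiftEl² prb = psubI-pshI² prb 0
substEl-shiftEl² prp = psubC-pshC² prp 0

-- The premises are what iterated ∀₂E computes on a schema in the 0-ary
-- variables of sort s: the instances come wrapped in identity renamings and
-- in substitutions into shifted formulas, which the lemmas above remove.
module _ {Γ : List MF} (s : Sort) where

  private
    ren : El s → El s
    ren = renEl s (λ x → x)

  instantiate₁ : (T : El s → MF) (A : El s) → Γ ⊢ₘ T (ren A) → Γ ⊢ₘ T A
  instantiate₁ T A = subst (λ X → Γ ⊢ₘ T X) (renEl-id s A)

  instantiate₂ : (T : El s → El s → MF) (A B : El s) →
                 Γ ⊢ₘ T (ren A) (substEl s 0 A (ren (shiftEl s B))) → Γ ⊢ₘ T A B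
  instantiate₂ T A B = subst (Γ ⊢ₘ_) (cong₂ T (renEl-id s A) B-residue)
    where
    B-residue : substEl s 0 A (ren (shiftEl s B)) ≡ B
    B-residue = trans (cong (substEl s 0 A) (renEl-id s _)) (substEl-shiftEl s A B)

  instantiate₃ : (T : El s → El s → El s → MF) (A B C : El s) →
                 Γ ⊢ₘ T (ren A) (substEl s 0 A (ren (shiftEl s B)))
                        (substEl s 0 A (substEl s 1 (shiftEl s B)
                                                    (ren (shiftEl s (shiftEl s C))))) →
                 Γ ⊢ₘ T A B C
  instantiate₃ T A B C d =
    subst (Γ ⊢ₘ_) (cong (T A B) C-residue) (instantiate₂ (λ a b → T a b C′) A B d)
    where
    C′ : El s
    C′ = substEl s 0 A (substEl s 1 (shiftEl s B) (ren (shiftEl s (shiftEl s C))))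

    C-residue : C′ ≡ C
    C-residue = begin
      C′
        ≡⟨ cong (λ X → substEl s 0 A (substEl s 1 (shiftEl s B) X)) (renEl-id s _) ⟩
      substEl s 0 A (substEl s 1 (shiftEl s B) (shiftEl s (shiftEl s C)))
        ≡⟨ cong (substEl s 0 A) (substEl-shiftEl² s (shiftEl s B) C) ⟩
      substEl s 0 A (shiftEl s C)
        ≡⟨ substEl-shiftEl s A C ⟩
      C ∎
      where open ≡-Reasoning

conjunct : ∀ {Γ} A As (k : Fin (length (A ∷ As))) → Γ ⊢ₘ conjM A As → Γ ⊢ₘ lookup (A ∷ As) k
conjunct A []       zero    d = d
conjunct A (B ∷ Bs) zero    d = &E₁ d
conjunct A (B ∷ Bs) (suc k) d = conjunct B Bs k (&E₂ d)

-- Natural-deduction proofs in a Hilbert system with K, S and modus ponens,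
-- compiled away by bracket abstraction.
module HilbertDeduction {F : Set} (_⊃_ : F → F → F) (⊢_ : F → Set)
  (K : ∀ A B → ⊢ (A ⊃ (B ⊃ A)))
  (S : ∀ A B C → ⊢ ((A ⊃ (B ⊃ C)) ⊃ ((A ⊃ B) ⊃ (A ⊃ C))))
  (mp : ∀ {A B} → ⊢ (A ⊃ B) → ⊢ A → ⊢ B) where

  infixl 5 _·_
  infixr 4 ƛ_

  ⊃-refl : ∀ A → ⊢ (A ⊃ A)
  ⊃-refl A = mp (mp (S A (A ⊃ A) A) (K A (A ⊃ A))) (K A A)

  data Combination (Δ : List F) : F → Set where
    var : ∀ {A} → A ∈ Δ → Combination Δ A
    thm : ∀ {A} → ⊢ A → Combination Δ A
    app : ∀ {A B} → Combination Δ (A ⊃ B) → Combination Δ A → Combination Δ B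

  bracket : ∀ {Δ A B} → Combination (A ∷ Δ) B → Combination Δ (A ⊃ B)
  bracket {A = A} (var (here refl)) = thm (⊃-refl A)
  bracket {A = A} (var (there x))   = app (thm (K _ A)) (var x)
  bracket {A = A} (thm d)           = app (thm (K _ A)) (thm d)
  bracket         (app f x)         = app (app (thm (S _ _ _)) (bracket f)) (bracket x)

  data Term (Δ : List F) : F → Set where
    var : ∀ {A} → A ∈ Δ → Term Δ A
    thm : ∀ {A} → ⊢ A → Term Δ A
    _·_ : ∀ {A B} → Term Δ (A ⊃ B) → Term Δ A → Term Δ B
    ƛ_  : ∀ {A B} → Term (A ∷ Δ) B → Term Δ (A ⊃ B)

  v₀ : ∀ {Δ A} → Term (A ∷ Δ) A
  v₀ = var (here refl)

  v₁ : ∀ {Δ A B} → Term (B ∷ A ∷ Δ) A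
  v₁ = var (there (here refl))

  compile : ∀ {Δ A} → Term Δ A → Combination Δ A
  compile (var x) = var x
  compile (thm d) = thm d
  compile (f · x) = app (compile f) (compile x)
  compile (ƛ t)   = bracket (compile t)

  evaluate : ∀ {A} → Combination [] A → ⊢ A
  evaluate (thm d)   = d
  evaluate (app f x) = mp (evaluate f) (evaluate x)

  close : ∀ {A} → Term [] A → ⊢ A
  close t = evaluate (compile t)

module Derivations {Γ : List MF} (hQ : QHC ∈ Γ) where

  infix 1 ⊢c_ ⊢i_
  infixr 9 _⨾ᶜ_ _⨾ⁱ_

  ⊢c_ : CF → Set
  ⊢c F = Γ ⊢ₘ c⟨ F ⟩

  ⊢i_ : IF → Set
  ⊢i Φ = Γ ⊢ₘ i⟨ Φ ⟩

  private
    axioms : List MF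
    axioms = principle (c ⊤c) ∷ QC ++ QH ++ QHCax

    axiom : (k : Fin (length axioms)) → Γ ⊢ₘ lookup axioms k
    axiom k = conjunct (principle (c ⊤c)) (QC ++ QH ++ QHCax) k (hyp hQ)

  c-K : ∀ A B → ⊢c A →c (B →c A)
  c-K A B = instantiate₂ prp (λ a b → c⟨ a →c (b →c a) ⟩) A B (∀₂E (∀₂E (axiom (# 1)) B) A)

  c-S : ∀ A B C → ⊢c (A →c (B →c C)) →c ((A →c B) →c (A →c C))
  c-S A B C = instantiate₃ prp (λ a b d → c⟨ (a →c (b →c d)) →c ((a →c b) →c (a →c d)) ⟩) A B C
                (∀₂E (∀₂E (∀₂E (axiom (# 2)) C) B) A)

  c-∧-fst : ∀ A B → ⊢c A ∧c B →c A
  c-∧-fst A B = instantiate₂ prp (λ a b → c⟨ a ∧c b →c a ⟩) A B (∀₂E (∀₂E (axiom (# 3)) B) A)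

  c-∧-snd : ∀ A B → ⊢c A ∧c B →c B
  c-∧-snd A B = instantiate₂ prp (λ a b → c⟨ a ∧c b →c b ⟩) A B (∀₂E (∀₂E (axiom (# 4)) B) A)

  c-∧-intro : ∀ A B → ⊢c A →c (B →c A ∧c B)
  c-∧-intro A B = instantiate₂ prp (λ a b → c⟨ a →c (b →c a ∧c b) ⟩) A B
      (∀₂E (∀₂E (axiom (# 5)) B) A)

  c-∨-inl : ∀ A B → ⊢c A →c A ∨c B
  c-∨-inl A B = instantiate₂ prp (λ a b → c⟨ a →c a ∨c b ⟩) A B (∀₂E (∀₂E (axiom (# 6)) B) A)

  c-∨-inr : ∀ A B → ⊢c B →c A ∨c B
  c-∨-inr A B = instantiate₂ prp (λ a b → c⟨ b →c a ∨c b ⟩) A B (∀₂E (∀₂E (axiom (# 7)) B) A)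

  c-∨-elim : ∀ A B C → ⊢c (A →c C) →c ((B →c C) →c (A ∨c B →c C))
  c-∨-elim A B C = instantiate₃ prp (λ a b d → c⟨ (a →c d) →c ((b →c d) →c (a ∨c b →c d)) ⟩) A B C
                     (∀₂E (∀₂E (∀₂E (axiom (# 8)) C) B) A)

  c-⊥-elim : ∀ A → ⊢c ⊥c →c A
  c-⊥-elim A = instantiate₁ prp (λ a → c⟨ ⊥c →c a ⟩) A (∀₂E (axiom (# 9)) A)

  c-⊤ : ⊢c ⊤c
  c-⊤ = axiom (# 10)

  c-dne : ∀ A → ⊢c ¬c ¬c A →c A
  c-dne A = instantiate₁ prp (λ a → c⟨ ¬c ¬c a →c a ⟩) A (∀₂E (axiom (# 11)) A)

  -- The quantifier principles and rules are left as meta-formulas: they are only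
  -- instantiated at concrete formulas, where ∀₂E and ∀₁E compute the instance.
  c-∀-elim : Γ ⊢ₘ principle (c (∀c (p₁ 0) →c p₁ 0))
  c-∀-elim = axiom (# 12)

  c-∃-intro : Γ ⊢ₘ principle (c (p₁ 0 →c ∃c (p₁ 0)))
  c-∃-intro = axiom (# 13)

  c-mp : ∀ {A B} → ⊢c A →c B → ⊢c A → ⊢c B
  c-mp {A} {B} A→B a =
    ⇒E (instantiate₂ prp (λ a b → c⟨ a ⟩ & c⟨ a →c b ⟩ ⇒ c⟨ b ⟩) A B (∀₂E (∀₂E (axiom (# 14)) B) A))
       (&I a A→B)

  c-∀-rule : Γ ⊢ₘ rule (c (p₀ →c p₁ 0)) [] (c (p₀ →c ∀c (p₁ 0)))
  c-∀-rule = axiom (# 15)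

  c-∃-rule : Γ ⊢ₘ rule (c (p₁ 0 →c p₀)) [] (c (∃c (p₁ 0) →c p₀))
  c-∃-rule = axiom (# 16)

  i-K : ∀ A B → ⊢i A →i (B →i A)
  i-K A B = instantiate₂ prb (λ a b → i⟨ a →i (b →i a) ⟩) A B (∀₂E (∀₂E (axiom (# 17)) B) A)

  i-S : ∀ A B C → ⊢i (A →i (B →i C)) →i ((A →i B) →i (A →i C))
  i-S A B C = instantiate₃ prb (λ a b d → i⟨ (a →i (b →i d)) →i ((a →i b) →i (a →i d)) ⟩) A B C
                (∀₂E (∀₂E (∀₂E (axiom (# 18)) C) B) A)

  i-∧-snd : ∀ A B → ⊢i A ∧i B →i B
  i-∧-snd A B = instantiate₂ prb (λ a b → i⟨ a ∧i b →i b ⟩) A B (∀₂E (∀₂E (axiom (# 20)) B) A)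

  i-∧-intro : ∀ A B → ⊢i A →i (B →i A ∧i B)
  i-∧-intro A B = instantiate₂ prb (λ a b → i⟨ a →i (b →i a ∧i b) ⟩) A B
      (∀₂E (∀₂E (axiom (# 21)) B) A)

  i-∨-elim : ∀ A B C → ⊢i (A →i C) →i ((B →i C) →i (A ∨i B →i C))
  i-∨-elim A B C = instantiate₃ prb (λ a b d → i⟨ (a →i d) →i ((b →i d) →i (a ∨i b →i d)) ⟩) A B C
                     (∀₂E (∀₂E (∀₂E (axiom (# 24)) C) B) A)

  i-⋏-elim : ∀ A → ⊢i ⋏ →i A
  i-⋏-elim A = instantiate₁ prb (λ a → i⟨ ⋏ →i a ⟩) A (∀₂E (axiom (# 25)) A)

  i-✓ : ⊢i ✓
  i-✓ = axiom (# 26)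

  i-∀-elim : Γ ⊢ₘ principle (i (∀i (θ₁ 0) →i θ₁ 0))
  i-∀-elim = axiom (# 27)

  i-∃-intro : Γ ⊢ₘ principle (i (θ₁ 0 →i ∃i (θ₁ 0)))
  i-∃-intro = axiom (# 28)

  i-mp : ∀ {A B} → ⊢i A →i B → ⊢i A → ⊢i B
  i-mp {A} {B} A→B a =
    ⇒E (instantiate₂ prb (λ a b → i⟨ a ⟩ & i⟨ a →i b ⟩ ⇒ i⟨ b ⟩) A B (∀₂E (∀₂E (axiom (# 29)) B) A))
       (&I a A→B)

  i-∀-rule : Γ ⊢ₘ rule (i (α₀ →i θ₁ 0)) [] (i (α₀ →i ∀i (θ₁ 0)))
  i-∀-rule = axiom (# 30)

  i-∃-rule : Γ ⊢ₘ rule (i (θ₁ 0 →i α₀)) [] (i (∃i (θ₁ 0) →i α₀))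
  i-∃-rule = axiom (# 31)

  ⁇-∨ : ∀ A B → ⊢c ⁇ (A ∨i B) ↔c ⁇ A ∨c ⁇ B
  ⁇-∨ A B = instantiate₂ prb (λ a b → c⟨ ⁇ (a ∨i b) ↔c ⁇ a ∨c ⁇ b ⟩) A B
      (∀₂E (∀₂E (axiom (# 33)) B) A)

  ⁇-→ : ∀ A B → ⊢c ⁇ (A →i B) →c (⁇ A →c ⁇ B)
  ⁇-→ A B = instantiate₂ prb (λ a b → c⟨ ⁇ (a →i b) →c (⁇ a →c ⁇ b) ⟩) A B
      (∀₂E (∀₂E (axiom (# 34)) B) A)

  ¬⁇⋏ : ⊢c ¬c ⁇ ⋏
  ¬⁇⋏ = axiom (# 35)

  ⁇-∃ : Γ ⊢ₘ principle (c (⁇ ∃i (θ₁ 0) ↔c ∃c (⁇ θ₁ 0)))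
  ⁇-∃ = axiom (# 36)

  ⁇-∀ : Γ ⊢ₘ principle (c (⁇ ∀i (θ₁ 0) →c ∀c (⁇ θ₁ 0)))
  ⁇-∀ = axiom (# 37)

  →!⁇ : ∀ A → ⊢i A →i ! ⁇ A
  →!⁇ A = instantiate₁ prb (λ a → i⟨ a →i ! ⁇ a ⟩) A (∀₂E (axiom (# 38)) A)

  ¬!⊥ : ⊢i ¬i ! ⊥c
  ¬!⊥ = axiom (# 39)

  ⁇!→ : ∀ A → ⊢c ⁇ ! A →c A
  ⁇!→ A = instantiate₁ prp (λ a → c⟨ ⁇ ! a →c a ⟩) A (∀₂E (axiom (# 40)) A)

  !→!⁇! : ∀ A → ⊢i ! A →i ! ⁇ ! A
  !→!⁇! A = instantiate₁ prp (λ a → i⟨ ! a →i ! ⁇ ! a ⟩) A (∀₂E (axiom (# 41)) A)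

  !-→ : ∀ A B → ⊢i ! (A →c B) →i (! A →i ! B)
  !-→ A B = instantiate₂ prp (λ a b → i⟨ ! (a →c b) →i (! a →i ! b) ⟩) A B
      (∀₂E (∀₂E (axiom (# 42)) B) A)

  !-elim : ∀ {A} → ⊢i ! A → ⊢c A
  !-elim {A} = ⇒E (instantiate₁ prp (λ a → i⟨ ! a ⟩ ⇒ c⟨ a ⟩) A (∀₂E (axiom (# 43)) A))

  !-intro : ∀ {A} → ⊢c A → ⊢i ! A
  !-intro {A} = ⇒E (instantiate₁ prp (λ a → c⟨ a ⟩ ⇒ i⟨ ! a ⟩) A (∀₂E (axiom (# 44)) A))

  module Cl = HilbertDeduction _→c_ ⊢c_ c-K c-S c-mp
  module Int = HilbertDeduction _→i_ ⊢i_ i-K i-S i-mp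

  _⨾ᶜ_ : ∀ {A B C} → ⊢c A →c B → ⊢c B →c C → ⊢c A →c C
  A→B ⨾ᶜ B→C = close (ƛ thm B→C · (thm A→B · v₀))
    where open Cl

  _⨾ⁱ_ : ∀ {A B C} → ⊢i A →i B → ⊢i B →i C → ⊢i A →i C
  A→B ⨾ⁱ B→C = close (ƛ thm B→C · (thm A→B · v₀))
    where open Int

  c-↔-intro : ∀ {A B} → ⊢c A →c B → ⊢c B →c A → ⊢c A ↔c B
  c-↔-intro A→B B→A = c-mp (c-mp (c-∧-intro _ _) A→B) B→A

  c-↔-fst : ∀ {A B} → ⊢c A ↔c B → ⊢c A →c B
  c-↔-fst = c-mp (c-∧-fst _ _)

  c-↔-snd : ∀ {A B} → ⊢c A ↔c B → ⊢c B →c A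
  c-↔-snd = c-mp (c-∧-snd _ _)

  i-↔-intro : ∀ {A B} → ⊢i A →i B → ⊢i B →i A → ⊢i A ↔i B
  i-↔-intro A→B B→A = i-mp (i-mp (i-∧-intro _ _) A→B) B→A

  i-↔-snd : ∀ {A B} → ⊢i A ↔i B → ⊢i B →i A
  i-↔-snd = i-mp (i-∧-snd _ _)

  ⁇-intro : ∀ {A} → ⊢i A → ⊢c ⁇ A
  ⁇-intro a = !-elim (i-mp (→!⁇ _) a)

  ⁇-mono : ∀ {A B} → ⊢i A →i B → ⊢c ⁇ A →c ⁇ B
  ⁇-mono A→B = c-mp (⁇-→ _ _) (⁇-intro A→B)

  !-mono : ∀ {A B} → ⊢c A →c B → ⊢i ! A →i ! B
  !-mono A→B = i-mp (!-→ _ _) (!-intro A→B)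

  c-∨-case : ∀ {A B C} → ⊢c A →c C → ⊢c B →c C → ⊢c A ∨c B →c C
  c-∨-case A→C B→C = c-mp (c-mp (c-∨-elim _ _ _) A→C) B→C

  c-∨-map : ∀ {A A′ B B′} → ⊢c A →c A′ → ⊢c B →c B′ → ⊢c A ∨c B →c A′ ∨c B′
  c-∨-map f g = c-∨-case (f ⨾ᶜ c-∨-inl _ _) (g ⨾ᶜ c-∨-inr _ _)

  i-∨-case : ∀ {A B C} → ⊢i A →i C → ⊢i B →i C → ⊢i A ∨i B →i C
  i-∨-case A→C B→C = i-mp (i-mp (i-∨-elim _ _ _) A→C) B→C

module KLemmas {Γ : List MF} (hQ : QHC ∈ Γ) where
  open Derivations hQ

  KAt : CF → Set
  KAt A = ⊢i ¬i ! (¬c A) →i ! A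

  -- ?!A reads "the problem of proving A is solved": A → ?!A says truth implies proof.
  Complete : CF → Set
  Complete A = ⊢c A →c ⁇ ! A

  K-instance : Γ ⊢ₘ Kprinciple → ∀ A → KAt A
  K-instance K A = instantiate₁ prp (λ a → i⟨ ¬i ! (¬c a) →i ! a ⟩) A (∀₂E K A)

  K⇒complete : (∀ A → KAt A) → ∀ A → Complete A
  K⇒complete K A = !-elim (i-mp (K B) ¬!¬B)
    where
    B : CF
    B = A →c ⁇ ! A
    ¬B→A : ⊢c ¬c B →c A
    ¬B→A = close (ƛ thm (c-dne A) · (ƛ v₁ · (ƛ thm (c-⊥-elim (⁇ ! A)) · (v₁ · v₀))))
      where open Cl
    ¬B→¬⁇!A : ⊢c ¬c B →c ¬c ⁇ ! A
    ¬B→¬⁇!A = close (ƛ ƛ v₁ · (ƛ v₁))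
      where open Cl
    ¬!¬B : ⊢i ¬i ! (¬c B)
    ¬!¬B = close (ƛ thm ¬!⊥ · (thm (!-→ (⁇ ! A) ⊥c) · (thm (!-mono ¬B→¬⁇!A) · v₀)
                                                  · (thm (!→!⁇! A) · (thm (!-mono ¬B→A) · v₀))))
      where open Int

  complete¬⇒K : ∀ A → Complete (¬c A) → KAt A
  complete¬⇒K A complete = →!⁇ _ ⨾ⁱ !-mono ⁇¬!¬A→A
    where
    ⁇¬!¬A→A : ⊢c ⁇ (¬i ! (¬c A)) →c A
    ⁇¬!¬A→A = close (ƛ thm (c-dne A) · (ƛ thm ¬⁇⋏ · (thm (⁇-→ _ ⋏) · v₁ · (thm complete · v₀))))
      where open Cl

  complete⇒Ka1 : (∀ A → Complete A) → ∀ A B → ⊢c (A →c B) ↔c ⁇ (! A →i ! B)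
  complete⇒Ka1 complete A B = c-↔-intro (complete _ ⨾ᶜ ⁇-mono (!-→ A B))
    (close (ƛ ƛ thm (⁇!→ B) · (thm (⁇-→ (! A) (! B)) · v₁ · (thm (complete A) · v₀))))
    where open Cl

  Ka1⇒complete : Γ ⊢ₘ Ka1 → ∀ A → Complete A
  Ka1⇒complete Ka1 A =
    close (ƛ thm (⁇-→ (! ⊤c) (! A)) · (thm (c-↔-fst Ka1-⊤A) · (ƛ v₁)) · thm (⁇-intro (!-intro c-⊤)))
    where
    open Cl
    Ka1-⊤A : ⊢c (⊤c →c A) ↔c ⁇ (! ⊤c →i ! A)
    Ka1-⊤A = instantiate₂ prp (λ a b → c⟨ (a →c b) ↔c ⁇ (! a →i ! b) ⟩) ⊤c A (∀₂E (∀₂E Ka1 A) ⊤c)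

  complete⇒Ka2 : (∀ A → Complete A) → ∀ A B → ⊢c A ∨c B ↔c ⁇ (! A ∨i ! B)
  complete⇒Ka2 complete A B = c-↔-intro
    (c-∨-map (complete A) (complete B) ⨾ᶜ c-↔-snd (⁇-∨ (! A) (! B)))
    (c-↔-fst (⁇-∨ (! A) (! B)) ⨾ᶜ c-∨-map (⁇!→ A) (⁇!→ B))

  Ka2⇒complete : Γ ⊢ₘ Ka2 → ∀ A → Complete A
  Ka2⇒complete Ka2 A =
    c-∨-inl A ⊥c ⨾ᶜ c-↔-fst Ka2-A⊥ ⨾ᶜ c-↔-fst (⁇-∨ (! A) (! ⊥c))
      ⨾ᶜ c-∨-case (Cl.⊃-refl _) (⁇!→ ⊥c ⨾ᶜ c-⊥-elim _)
    where
    Ka2-A⊥ : ⊢c A ∨c ⊥c ↔c ⁇ (! A ∨i ! ⊥c)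
    Ka2-A⊥ = instantiate₂ prp (λ a b → c⟨ a ∨c b ↔c ⁇ (! a ∨i ! b) ⟩) A ⊥c (∀₂E (∀₂E Ka2 ⊥c) A)

  K⇒p→⁇∃! : Kprinciple ∈ Γ → ⊢c p₁ 0 →c ⁇ ∃i (! p₁ 0)
  K⇒p→⁇∃! hK = K⇒complete (K-instance (hyp hK)) (p₁ 0) ⨾ᶜ ⁇-mono (∀₁E (∀₂E i-∃-intro (! p₁ 0)) 0)

  ⁇!p→∃p : ⊢c ⁇ ! p₁ 0 →c ∃c (p₁ 0)
  ⁇!p→∃p = ⁇!→ (p₁ 0) ⨾ᶜ ∀₁E (∀₂E c-∃-intro (p₁ 0)) 0

  !∀p→!p : ⊢i ! ∀c (p₁ 0) →i ! p₁ 0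
  !∀p→!p = !-mono (∀₁E (∀₂E c-∀-elim (p₁ 0)) 0)

  ∀⁇!p→p : ⊢c ∀c (⁇ ! p₁ 0) →c p₁ 0
  ∀⁇!p→p = ∀₁E (∀₂E c-∀-elim (⁇ ! p₁ 0)) 0 ⨾ᶜ ⁇!→ (p₁ 0)

-- Closed meta-formulas such as QHC are fixed by renM suc, so this also turns
-- QHC ∈ Γ into QHC ∈ map (renM suc) Γ, the context after ∀₁I.
weaken : ∀ {Γ A} → A ∈ Γ → renM suc A ∈ map (renM suc) Γ
weaken = ∈-map⁺ (renM suc)

module _ {Γ : List MF} (hQ : QHC ∈ Γ) where
  open Derivations hQ
  open KLemmas hQ
  private
    Γ↑ : List MF
    Γ↑ = map (renM suc) Γ
    module ↑ = Derivations {Γ↑} (weaken hQ)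
    module K↑ = KLemmas {Γ↑} (weaken hQ)

  K⇒Ka3 : Kprinciple ∈ Γ → ⊢c ∃c (p₁ 0) ↔c ⁇ ∃i (! p₁ 0)
  K⇒Ka3 hK = c-↔-intro
    (⇒E (∀₂E (∀₂E c-∃-rule (p₁ 0)) (⁇ ∃i (! p₁ 0))) (∀₁I (K↑.K⇒p→⁇∃! (weaken hK))))
    (c-↔-fst (∀₂E ⁇-∃ (! p₁ 0)) ⨾ᶜ ⇒E (∀₂E (∀₂E c-∃-rule (⁇ ! p₁ 0)) (∃c (p₁ 0))) (∀₁I K↑.⁇!p→∃p))

  Ka3⇒complete¬p : Γ ⊢ₘ Ka3 → Complete (¬c p₀)
  Ka3⇒complete¬p Ka3 =
    ∀₁E (∀₂E c-∃-intro X) 0 ⨾ᶜ c-↔-fst (∀₂E Ka3 X) ⨾ᶜ c-↔-fst (∀₂E ⁇-∃ (! X))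
      ⨾ᶜ ⇒E (∀₂E (∀₂E c-∃-rule (⁇ ! X)) (⁇ ! X)) (∀₁I (↑.Cl.⊃-refl (⁇ ! X)))
    where
    X : CF
    X = ¬c p₀

  K⇒Ka4 : Kprinciple ∈ Γ → ⊢c ∀c (p₁ 0) ↔c ⁇ ∀i (! p₁ 0)
  K⇒Ka4 hK = c-↔-intro
    (K⇒complete (K-instance (hyp hK)) (∀c (p₁ 0))
      ⨾ᶜ ⁇-mono (⇒E (∀₂E (∀₂E i-∀-rule (! ∀c (p₁ 0))) (! p₁ 0)) (∀₁I K↑.!∀p→!p)))
    (∀₂E ⁇-∀ (! p₁ 0) ⨾ᶜ ⇒E (∀₂E (∀₂E c-∀-rule (∀c (⁇ ! p₁ 0))) (p₁ 0)) (∀₁I K↑.∀⁇!p→p))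

  Ka4⇒complete¬p : Γ ⊢ₘ Ka4 → Complete (¬c p₀)
  Ka4⇒complete¬p Ka4 =
    ⇒E (∀₂E (∀₂E c-∀-rule X) X) (∀₁I (↑.Cl.⊃-refl X)) ⨾ᶜ c-↔-fst (∀₂E Ka4 X)
      ⨾ᶜ ⁇-mono (∀₁E (∀₂E i-∀-elim (! X)) 0)
    where
    X : CF
    X = ¬c p₀

module PCLemmas {Γ : List MF} (hQ : QHC ∈ Γ) where
  open Derivations hQ

  PCAt : IF → Set
  PCAt Φ = ⊢i ! ⁇ Φ →i Φ

  PC-instance : Γ ⊢ₘ PCprinciple → ∀ Φ → PCAt Φ
  PC-instance PC Φ = instantiate₁ prb (λ a → i⟨ ! ⁇ a →i a ⟩) Φ (∀₂E PC Φ)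

  PC⇒Pb1 : (∀ Φ → PCAt Φ) → ∀ Φ Ψ → ⊢i (Φ →i Ψ) ↔i ! (⁇ Φ →c ⁇ Ψ)
  PC⇒Pb1 PC Φ Ψ = i-↔-intro (→!⁇ _ ⨾ⁱ !-mono (⁇-→ Φ Ψ))
    (close (ƛ ƛ thm (PC Ψ) · (thm (!-→ (⁇ Φ) (⁇ Ψ)) · v₁ · (thm (→!⁇ Φ) · v₀))))
    where open Int

  Pb1⇒PC : Γ ⊢ₘ Pb1 → ∀ Φ → PCAt Φ
  Pb1⇒PC Pb1 Φ = close (ƛ thm (i-↔-snd Pb1-✓Φ) · (thm (!-mono (c-K (⁇ Φ) (⁇ ✓))) · v₀) · thm i-✓)
    where
    open Int
    Pb1-✓Φ : ⊢i (✓ →i Φ) ↔i ! (⁇ ✓ →c ⁇ Φ)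
    Pb1-✓Φ = instantiate₂ prb (λ a b → i⟨ (a →i b) ↔i ! (⁇ a →c ⁇ b) ⟩) ✓ Φ (∀₂E (∀₂E Pb1 Φ) ✓)

  PC⇒Pb2 : (∀ Φ → PCAt Φ) → ∀ Φ Ψ → ⊢i Φ ∨i Ψ ↔i ! (⁇ Φ ∨c ⁇ Ψ)
  PC⇒Pb2 PC Φ Ψ = i-↔-intro (→!⁇ _ ⨾ⁱ !-mono (c-↔-fst (⁇-∨ Φ Ψ)))
                            (!-mono (c-↔-snd (⁇-∨ Φ Ψ)) ⨾ⁱ PC (Φ ∨i Ψ))

  Pb2⇒PC : Γ ⊢ₘ Pb2 → ∀ Φ → PCAt Φ
  Pb2⇒PC Pb2 Φ =
    !-mono (c-∨-inl (⁇ Φ) (⁇ ⋏)) ⨾ⁱ i-↔-snd Pb2-Φ⋏ ⨾ⁱ i-∨-case (Int.⊃-refl Φ) (i-⋏-elim Φ)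
    where
    Pb2-Φ⋏ : ⊢i Φ ∨i ⋏ ↔i ! (⁇ Φ ∨c ⁇ ⋏)
    Pb2-Φ⋏ = instantiate₂ prb (λ a b → i⟨ a ∨i b ↔i ! (⁇ a ∨c ⁇ b) ⟩) Φ ⋏ (∀₂E (∀₂E Pb2 ⋏) Φ)

  PC⇒Pb3 : Γ ⊢ₘ PCprinciple → ⊢i ∃i (θ₁ 0) ↔i ! ∃c (⁇ θ₁ 0)
  PC⇒Pb3 PC = i-↔-intro (→!⁇ (∃i (θ₁ 0)) ⨾ⁱ !-mono (c-↔-fst (∀₂E ⁇-∃ (θ₁ 0))))
                        (!-mono (c-↔-snd (∀₂E ⁇-∃ (θ₁ 0))) ⨾ⁱ PC-instance PC (∃i (θ₁ 0)))

  PC⇒!∀⁇θ→θ : PCprinciple ∈ Γ → ⊢i ! ∀c (⁇ θ₁ 0) →i θ₁ 0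
  PC⇒!∀⁇θ→θ hPC = !-mono (∀₁E (∀₂E c-∀-elim (⁇ θ₁ 0)) 0) ⨾ⁱ PC-instance (hyp hPC) (θ₁ 0)

module _ {Γ : List MF} (hQ : QHC ∈ Γ) where
  open Derivations hQ
  open PCLemmas hQ
  private
    Γ↑ : List MF
    Γ↑ = map (renM suc) Γ
    module ↑ = Derivations {Γ↑} (weaken hQ)
    module PC↑ = PCLemmas {Γ↑} (weaken hQ)

  Pb3⇒PCα : Γ ⊢ₘ Pb3 → PCAt α₀
  Pb3⇒PCα Pb3 =
    !-mono (∀₁E (∀₂E c-∃-intro (⁇ α₀)) 0) ⨾ⁱ i-↔-snd (∀₂E Pb3 α₀)
      ⨾ⁱ ⇒E (∀₂E (∀₂E i-∃-rule α₀) α₀) (∀₁I (↑.Int.⊃-refl α₀))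

  PC⇒Pb4 : PCprinciple ∈ Γ → ⊢i ∀i (θ₁ 0) ↔i ! ∀c (⁇ θ₁ 0)
  PC⇒Pb4 hPC = i-↔-intro
    (→!⁇ (∀i (θ₁ 0)) ⨾ⁱ !-mono (∀₂E ⁇-∀ (θ₁ 0)))
    (⇒E (∀₂E (∀₂E i-∀-rule (! ∀c (⁇ θ₁ 0))) (θ₁ 0)) (∀₁I (PC↑.PC⇒!∀⁇θ→θ (weaken hPC))))

  Pb4⇒PCα : Γ ⊢ₘ Pb4 → PCAt α₀
  Pb4⇒PCα Pb4 =
    !-mono (⇒E (∀₂E (∀₂E c-∀-rule (⁇ α₀)) (⁇ α₀)) (∀₁I (↑.Cl.⊃-refl (⁇ α₀))))
      ⨾ⁱ i-↔-snd (∀₂E Pb4 α₀) ⨾ⁱ ∀₁E (∀₂E i-∀-elim α₀) 0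

-- Under ∀₂I the context becomes map (pshM …) of this one, which is again this
-- list because the principles in it are closed; hence qhc and here refl still apply.
derive : ∀ {𝓕 𝓖} → 𝓕 ∷ QHC ∷ [] ⊢ₘ 𝓖 → 𝓕 ⊢QHC 𝓖
derive d = ⇒I (⇒I d)

qhc : ∀ {𝓕} → QHC ∈ 𝓕 ∷ QHC ∷ []
qhc = there (here refl)

open KLemmas using (K-instance; K⇒complete; complete¬⇒K; complete⇒Ka1; Ka1⇒complete;
                    complete⇒Ka2; Ka2⇒complete)
open PCLemmas using (PC-instance; PC⇒Pb1; Pb1⇒PC; PC⇒Pb2; Pb2⇒PC; PC⇒Pb3)

K⊢Ka1 : Kprinciple ⊢QHC Ka1
K⊢Ka1 = derive (∀₂I (∀₂I
  (complete⇒Ka1 qhc (K⇒complete qhc (K-instance qhc (hyp (here refl)))) p₀ q₀)))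

Ka1⊢K : Ka1 ⊢QHC Kprinciple
Ka1⊢K = derive (∀₂I (complete¬⇒K qhc p₀ (Ka1⇒complete qhc (hyp (here refl)) (¬c p₀))))

K⊢Ka2 : Kprinciple ⊢QHC Ka2
K⊢Ka2 = derive (∀₂I (∀₂I
  (complete⇒Ka2 qhc (K⇒complete qhc (K-instance qhc (hyp (here refl)))) p₀ q₀)))

Ka2⊢K : Ka2 ⊢QHC Kprinciple
Ka2⊢K = derive (∀₂I (complete¬⇒K qhc p₀ (Ka2⇒complete qhc (hyp (here refl)) (¬c p₀))))

K⊢Ka3 : Kprinciple ⊢QHC Ka3
K⊢Ka3 = derive (∀₂I (K⇒Ka3 qhc (here refl)))

Ka3⊢K : Ka3 ⊢QHC Kprinciple
Ka3⊢K = derive (∀₂I (complete¬⇒K qhc p₀ (Ka3⇒complete¬p qhc (hyp (here refl)))))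

K⊢Ka4 : Kprinciple ⊢QHC Ka4
K⊢Ka4 = derive (∀₂I (K⇒Ka4 qhc (here refl)))

Ka4⊢K : Ka4 ⊢QHC Kprinciple
Ka4⊢K = derive (∀₂I (complete¬⇒K qhc p₀ (Ka4⇒complete¬p qhc (hyp (here refl)))))

PC⊢Pb1 : PCprinciple ⊢QHC Pb1
PC⊢Pb1 = derive (∀₂I (∀₂I (PC⇒Pb1 qhc (PC-instance qhc (hyp (here refl))) α₀ β₀)))

Pb1⊢PC : Pb1 ⊢QHC PCprinciple
Pb1⊢PC = derive (∀₂I (Pb1⇒PC qhc (hyp (here refl)) α₀))

PC⊢Pb2 : PCprinciple ⊢QHC Pb2
PC⊢Pb2 = derive (∀₂I (∀₂I (PC⇒Pb2 qhc (PC-instance qhc (hyp (here refl))) α₀ β₀)))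

Pb2⊢PC : Pb2 ⊢QHC PCprinciple
Pb2⊢PC = derive (∀₂I (Pb2⇒PC qhc (hyp (here refl)) α₀))

PC⊢Pb3 : PCprinciple ⊢QHC Pb3
PC⊢Pb3 = derive (∀₂I (PC⇒Pb3 qhc (hyp (here refl))))

Pb3⊢PC : Pb3 ⊢QHC PCprinciple
Pb3⊢PC = derive (∀₂I (Pb3⇒PCα qhc (hyp (here refl))))

PC⊢Pb4 : PCprinciple ⊢QHC Pb4
PC⊢Pb4 = derive (∀₂I (PC⇒Pb4 qhc (here refl)))

Pb4⊢PC : Pb4 ⊢QHC PCprinciple
Pb4⊢PC = derive (∀₂I (Pb4⇒PCα qhc (hyp (here refl))))

mainTheorem15 : ((Kprinciple ≣QHC Ka1) × (Kprinciple ≣QHC Ka2)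
                  × (Kprinciple ≣QHC Ka3) × (Kprinciple ≣QHC Ka4))
                × ((PCprinciple ≣QHC Pb1) × (PCprinciple ≣QHC Pb2)
                  × (PCprinciple ≣QHC Pb3) × (PCprinciple ≣QHC Pb4))
mainTheorem15 = ((K⊢Ka1 , Ka1⊢K) , (K⊢Ka2 , Ka2⊢K) , (K⊢Ka3 , Ka3⊢K) , (K⊢Ka4 , Ka4⊢K))
              , ((PC⊢Pb1 , Pb1⊢PC) , (PC⊢Pb2 , Pb2⊢PC) , (PC⊢Pb3 , Pb3⊢PC) , (PC⊢Pb4 , Pb4⊢PC))
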